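{- Let $q$ be a power of $3$ and let $L$ be a line of $PG(3,q)$ not meeting the axis $y_0=y_3=0$. Scale its Plücker coordinates so that $f_L=z_0X^4+z_1X^3Y+X^2Y^2+z_3XY^3+z_4Y^4$. Then the pencil of planes of $PG(3,q)$ containing $L$ is, under the identification of planes with binary cubic forms, the pencil spanned by $z_1X^3-X^2Y+z_4Y^3$ and $z_0X^3-XY^2+z_3Y^3$.
   Context: Points of $PG(3,q)$ are $(y_0:y_1:y_2:y_3)$. For the line $L$ through distinct points $x,y$, Plücker coordinates are $p_{ij}=x_iy_j-x_jy_i$ and $f_L=p_{23}X^4+p_{13}X^3Y+p_{03}X^2Y^2+p_{02}XY^3+p_{01}Y^4$ (a line not meeting the axis has $p_{03}\ne0$). The plane $a_0y_0+a_1y_1+a_2y_2+a_3y_3=0$ is identified with the binary cubic form $a_0X^3+a_1X^2Y+a_2XY^2+a_3Y^3$. -}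

module Defs where

open import Level using (Level; _⊔_)
open import Data.Nat using (ℕ; _^_)
open import Data.Fin using (Fin; suc)
open Fin using (zero)
open import Data.Product using (Σ; ∃; _×_; _,_)
open import Relation.Nullary using (¬_)
open import Relation.Binary.PropositionalEquality using (_≡_)
open import Algebra.Bundles using (CommutativeRing)

record IsFieldOfOrder {c ℓ : Level} (R : CommutativeRing c ℓ) (q : ℕ) : Set (c ⊔ ℓ) where
  open CommutativeRing R hiding (zero)
  field
    1≉0     : ¬ (1# ≈ 0#)
    inverse : ∀ x → ¬ (x ≈ 0#) → ∃ λ y → x * y ≈ 1#
    enum    : Fin q → Carrier
    enum-injective  : ∀ i j → enum i ≈ enum j → i ≡ j
    enum-surjective : ∀ x → ∃ λ i → enum i ≈ x

module PG3 {c ℓ : Level} (R : CommutativeRing c ℓ) where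
  open CommutativeRing R hiding (zero)

  -- vectors of homogeneous coordinates (y0 : y1 : y2 : y3) / plane coefficients
  Vec4 : Set c
  Vec4 = Fin 4 → Carrier

  c0 c1 c2 c3 : Fin 4
  c0 = zero
  c1 = suc zero
  c2 = suc (suc zero)
  c3 = suc (suc (suc zero))

  IsZeroVec : Vec4 → Set ℓ
  IsZeroVec v = ∀ i → v i ≈ 0#

  IsPoint : Vec4 → Set ℓ
  IsPoint v = ¬ IsZeroVec v

  SamePoint : Vec4 → Vec4 → Set (c ⊔ ℓ)
  SamePoint x y = ∃ λ t → ¬ (t ≈ 0#) × (∀ i → y i ≈ t * x i)

  lincomb : Carrier → Vec4 → Carrier → Vec4 → Vec4
  lincomb l x m y i = l * x i + m * y i

  OnLine : Vec4 → Vec4 → Vec4 → Set (c ⊔ ℓ)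
  OnLine x y z = IsPoint z × (∃ λ l → ∃ λ m → ∀ i → z i ≈ l * x i + m * y i)

  AvoidsAxis : Vec4 → Vec4 → Set (c ⊔ ℓ)
  AvoidsAxis x y = ∀ z → OnLine x y z → ¬ (z c0 ≈ 0# × z c3 ≈ 0#)

  plucker : Vec4 → Vec4 → Fin 4 → Fin 4 → Carrier
  plucker x y i j = x i * y j - x j * y i

  eval : Vec4 → Vec4 → Carrier
  eval a v = a c0 * v c0 + a c1 * v c1 + a c2 * v c2 + a c3 * v c3

  ContainsLine : Vec4 → Vec4 → Vec4 → Set (c ⊔ ℓ)
  ContainsLine a x y = ∀ z → OnLine x y z → eval a z ≈ 0#

  -- binary cubic form a0 X^3 + a1 X^2 Y + a2 X Y^2 + a3 Y^3 ↔ coefficient vector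
  cubic : Carrier → Carrier → Carrier → Carrier → Vec4
  cubic a0 a1 a2 a3 zero = a0
  cubic a0 a1 a2 a3 (suc zero) = a1
  cubic a0 a1 a2 a3 (suc (suc zero)) = a2
  cubic a0 a1 a2 a3 (suc (suc (suc zero))) = a3

  InPencil : Vec4 → Vec4 → Vec4 → Set (c ⊔ ℓ)
  InPencil u v a = ∃ λ l → ∃ λ m → ∀ i → a i ≈ l * u i + m * v i

-- Put u = z₁X³ − X²Y + z₄Y³ and v = z₀X³ − XY² + z₃Y³. Each vanishes on every
-- point λx + μy of L, e.g. u·(λx + μy) = (λx₁ + μy₁)(p₀₃w − 1) = 0 by the
-- normalisation p₀₃w = 1, so every plane of their pencil contains L. Conversely
-- a plane a through x and y is (−a₁)u + (−a₂)v: the middle coefficients match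
-- trivially and the outer ones by the identities
--   a₀ p₀₃ = −a₁ p₁₃ − a₂ p₂₃ + y₃ (a·x) − x₃ (a·y),
--   a₃ p₀₃ = −a₁ p₀₁ − a₂ p₀₂ + x₀ (a·y) − y₀ (a·x).
module Submission where

open import Defs
open import Level using (Level)
open import Data.Nat as ℕ using (ℕ; zero; suc; _^_)
open import Data.Integer as ℤ using (ℤ; +_; -[1+_]; _⊖_)
open import Data.Integer.Properties as ℤ using ([1+m]⊖[1+n]≡m⊖n)
open import Data.Nat.Properties using (+-suc)
open import Data.Sign as Sign using (Sign)
open import Data.Maybe using (Maybe; just; nothing)
open import Data.Product using (_×_; _,_)
open import Data.Fin using (suc)
open Data.Fin.Fin using (zero)
open import Relation.Nullary using (¬_; yes; no)
import Relation.Binary.PropositionalEquality as ≡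
open import Function.Bundles using (_⇔_; mk⇔)
open import Algebra.Bundles using (CommutativeRing)
import Algebra.Solver.Ring
import Algebra.Solver.Ring.AlmostCommutativeRing as ACR
import Algebra.Properties.Ring as RingProperties
import Algebra.Properties.CommutativeSemigroup as CommutativeSemigroupProperties
import Algebra.Properties.Semiring.Mult as SemiringMult
import Algebra.Properties.Monoid.Mult as MonoidMult

-- Integer coefficients make cancellation of coefficients a computation, so that
-- `solve … refl` works over an arbitrary commutative ring R.
module IntegerCoefficientSolver {c ℓ} (R : CommutativeRing c ℓ) where
  open CommutativeRing R
  open RingProperties ring
  open SemiringMult semiring using (×1-homo-*)
  open MonoidMult +-monoid using (×-homo-+) renaming (_×_ to _·_)
  open import Relation.Binary.Reasoning.Setoid setoid

  ⟦_⟧ℕ : ℕ → Carrier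
  ⟦ n ⟧ℕ = n · 1#

  ⟦_⟧ℤ : ℤ → Carrier
  ⟦ + n ⟧ℤ = ⟦ n ⟧ℕ
  ⟦ -[1+ n ] ⟧ℤ = - ⟦ suc n ⟧ℕ

  [x+a]-[x+b]≈a-b : ∀ x a b → (x + a) - (x + b) ≈ a - b
  [x+a]-[x+b]≈a-b x a b = begin
    (x + a) - (x + b)      ≈⟨ +-congˡ (-‿+-comm x b) ⟨
    (x + a) + (- x + - b)  ≈⟨ CommutativeSemigroupProperties.interchange +-commutativeSemigroup x a (- x) (- b) ⟩
    (x - x) + (a - b)      ≈⟨ +-congʳ (-‿inverseʳ x) ⟩
    0# + (a - b)           ≈⟨ +-identityˡ _ ⟩
    a - b                  ∎

  ⊖-homo : ∀ m n → ⟦ m ⊖ n ⟧ℤ ≈ ⟦ m ⟧ℕ - ⟦ n ⟧ℕ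
  ⊖-homo m zero = sym (trans (+-congˡ -0#≈0#) (+-identityʳ _))
  ⊖-homo zero (suc n) = sym (+-identityˡ _)
  ⊖-homo (suc m) (suc n) rewrite [1+m]⊖[1+n]≡m⊖n m n =
    trans (⊖-homo m n) (sym ([x+a]-[x+b]≈a-b 1# ⟦ m ⟧ℕ ⟦ n ⟧ℕ))

  +-homo : ∀ i j → ⟦ i ℤ.+ j ⟧ℤ ≈ ⟦ i ⟧ℤ + ⟦ j ⟧ℤ
  +-homo -[1+ m ] -[1+ n ] = begin
    - ⟦ suc (suc (m ℕ.+ n)) ⟧ℕ   ≡⟨ ≡.cong (λ k → - ⟦ suc k ⟧ℕ) (≡.sym (+-suc m n)) ⟩
    - ⟦ suc m ℕ.+ suc n ⟧ℕ       ≈⟨ -‿cong (×-homo-+ 1# (suc m) (suc n)) ⟩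
    - (⟦ suc m ⟧ℕ + ⟦ suc n ⟧ℕ)  ≈⟨ -‿+-comm _ _ ⟨
    - ⟦ suc m ⟧ℕ + - ⟦ suc n ⟧ℕ  ∎
  +-homo -[1+ m ] (+ n) = trans (⊖-homo n (suc m)) (+-comm _ _)
  +-homo (+ m) -[1+ n ] = ⊖-homo m (suc n)
  +-homo (+ m) (+ n) = ×-homo-+ 1# m n

  signed : Sign → Carrier → Carrier
  signed Sign.+ x = x
  signed Sign.- x = - x

  signed-cong : ∀ s {x y} → x ≈ y → signed s x ≈ signed s y
  signed-cong Sign.+ x≈y = x≈y
  signed-cong Sign.- x≈y = -‿cong x≈y

  signed-* : ∀ s t a b → signed (s Sign.* t) (a * b) ≈ signed s a * signed t b
  signed-* Sign.+ Sign.+ a b = refl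
  signed-* Sign.+ Sign.- a b = -‿distribʳ-* a b
  signed-* Sign.- Sign.+ a b = -‿distribˡ-* a b
  signed-* Sign.- Sign.- a b = begin
    a * b        ≈⟨ -‿involutive _ ⟨
    - - (a * b)  ≈⟨ -‿cong (-‿distribʳ-* a b) ⟩
    - (a * - b)  ≈⟨ -‿distribˡ-* a (- b) ⟩
    - a * - b    ∎

  ◃-homo : ∀ s n → ⟦ s ℤ.◃ n ⟧ℤ ≈ signed s ⟦ n ⟧ℕ
  ◃-homo Sign.+ zero = refl
  ◃-homo Sign.+ (suc n) = refl
  ◃-homo Sign.- zero = sym -0#≈0#
  ◃-homo Sign.- (suc n) = refl

  signed-sign-abs : ∀ i → signed (ℤ.sign i) ⟦ ℤ.∣ i ∣ ⟧ℕ ≈ ⟦ i ⟧ℤ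
  signed-sign-abs (+ n) = refl
  signed-sign-abs -[1+ n ] = refl

  *-homo : ∀ i j → ⟦ i ℤ.* j ⟧ℤ ≈ ⟦ i ⟧ℤ * ⟦ j ⟧ℤ
  *-homo i j = begin
    ⟦ i ℤ.* j ⟧ℤ                                       ≈⟨ ◃-homo s (ℤ.∣ i ∣ ℕ.* ℤ.∣ j ∣) ⟩
    signed s ⟦ ℤ.∣ i ∣ ℕ.* ℤ.∣ j ∣ ⟧ℕ                  ≈⟨ signed-cong s (×1-homo-* ℤ.∣ i ∣ ℤ.∣ j ∣) ⟩
    signed s (⟦ ℤ.∣ i ∣ ⟧ℕ * ⟦ ℤ.∣ j ∣ ⟧ℕ)             ≈⟨ signed-* (ℤ.sign i) (ℤ.sign j) _ _ ⟩
    signed (ℤ.sign i) ⟦ ℤ.∣ i ∣ ⟧ℕ * signed (ℤ.sign j) ⟦ ℤ.∣ j ∣ ⟧ℕ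
                                                       ≈⟨ *-cong (signed-sign-abs i) (signed-sign-abs j) ⟩
    ⟦ i ⟧ℤ * ⟦ j ⟧ℤ                                    ∎
    where s = ℤ.sign i Sign.* ℤ.sign j

  -‿homo : ∀ i → ⟦ ℤ.- i ⟧ℤ ≈ - ⟦ i ⟧ℤ
  -‿homo -[1+ n ] = sym (-‿involutive _)
  -‿homo (+ zero) = sym -0#≈0#
  -‿homo (+ suc n) = refl

  ℤ⟶R : ℤ.+-*-rawRing ACR.-Raw-AlmostCommutative⟶ ACR.fromCommutativeRing R
  ℤ⟶R = record
    { ⟦_⟧ = ⟦_⟧ℤ
    ; +-homo = +-homo
    ; *-homo = *-homo
    ; -‿homo = -‿homo
    ; 0-homo = refl
    ; 1-homo = +-identityʳ 1#
    }

  ⟦⟧-≟ : ∀ i j → Maybe (⟦ i ⟧ℤ ≈ ⟦ j ⟧ℤ)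
  ⟦⟧-≟ i j with i ℤ.≟ j
  ... | yes ≡.refl = just refl
  ... | no _ = nothing

  open Algebra.Solver.Ring ℤ.+-*-rawRing (ACR.fromCommutativeRing R) ℤ⟶R ⟦⟧-≟ public

module PlanesThroughLine {c ℓ} (R : CommutativeRing c ℓ) where
  open CommutativeRing R hiding (zero)
  open PG3 R
  open IntegerCoefficientSolver R
  open import Relation.Binary.Reasoning.Setoid setoid

  eval-comm : ∀ a v → eval a v ≈ eval v a
  eval-comm a v = solve 8
    (λ a0 a1 a2 a3 v0 v1 v2 v3 →
      a0 :* v0 :+ a1 :* v1 :+ a2 :* v2 :+ a3 :* v3 := v0 :* a0 :+ v1 :* a1 :+ v2 :* a2 :+ v3 :* a3)
    refl (a c0) (a c1) (a c2) (a c3) (v c0) (v c1) (v c2) (v c3)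

  eval-lincombʳ : ∀ a l x m y → eval a (lincomb l x m y) ≈ l * eval a x + m * eval a y
  eval-lincombʳ a l x m y = solve 14
    (λ a0 a1 a2 a3 l m x0 x1 x2 x3 y0 y1 y2 y3 →
      a0 :* (l :* x0 :+ m :* y0) :+ a1 :* (l :* x1 :+ m :* y1)
        :+ a2 :* (l :* x2 :+ m :* y2) :+ a3 :* (l :* x3 :+ m :* y3)
      := l :* (a0 :* x0 :+ a1 :* x1 :+ a2 :* x2 :+ a3 :* x3)
        :+ m :* (a0 :* y0 :+ a1 :* y1 :+ a2 :* y2 :+ a3 :* y3))
    refl (a c0) (a c1) (a c2) (a c3) l m (x c0) (x c1) (x c2) (x c3) (y c0) (y c1) (y c2) (y c3)

  eval-lincombˡ : ∀ l a m b v → eval (lincomb l a m b) v ≈ l * eval a v + m * eval b v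
  eval-lincombˡ l a m b v = begin
    eval (lincomb l a m b) v     ≈⟨ eval-comm (lincomb l a m b) v ⟩
    eval v (lincomb l a m b)     ≈⟨ eval-lincombʳ v l a m b ⟩
    l * eval v a + m * eval v b  ≈⟨ +-cong (*-congˡ (eval-comm v a)) (*-congˡ (eval-comm v b)) ⟩
    l * eval a v + m * eval b v  ∎

  eval-congˡ : ∀ {a b} v → (∀ i → a i ≈ b i) → eval a v ≈ eval b v
  eval-congˡ v a≈b =
    +-cong (+-cong (+-cong (*-congʳ (a≈b c0)) (*-congʳ (a≈b c1))) (*-congʳ (a≈b c2))) (*-congʳ (a≈b c3))

  eval-congʳ : ∀ a {v w} → (∀ i → v i ≈ w i) → eval a v ≈ eval a w
  eval-congʳ a {v} {w} v≈w = begin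
    eval a v  ≈⟨ eval-comm a v ⟩
    eval v a  ≈⟨ eval-congˡ a v≈w ⟩
    eval w a  ≈⟨ eval-comm w a ⟩
    eval a w  ∎

  combination-of-zeros : ∀ l m {s t} → s ≈ 0# → t ≈ 0# → l * s + m * t ≈ 0#
  combination-of-zeros l m {s} {t} s≈0 t≈0 = begin
    l * s + m * t    ≈⟨ +-cong (*-congˡ s≈0) (*-congˡ t≈0) ⟩
    l * 0# + m * 0#  ≈⟨ +-cong (zeroʳ l) (zeroʳ m) ⟩
    0# + 0#          ≈⟨ +-identityʳ 0# ⟩
    0#               ∎

  containsLine⇒eval≈0 : ∀ a {x y} → IsPoint x → IsPoint y →
                        ContainsLine a x y → eval a x ≈ 0# × eval a y ≈ 0#
  containsLine⇒eval≈0 a {x} {y} px py contains = contains x x-on-line , contains y y-on-line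
    where
    x-on-line : OnLine x y x
    x-on-line = px , 1# , 0# , λ _ → sym (trans (+-congˡ (zeroˡ _)) (trans (+-identityʳ _) (*-identityˡ _)))

    y-on-line : OnLine x y y
    y-on-line = py , 0# , 1# , λ _ → sym (trans (+-congʳ (zeroˡ _)) (trans (+-identityˡ _) (*-identityˡ _)))

  module Pencil (x y : Vec4) (w : Carrier) where
    p₀₃ : Carrier
    p₀₃ = plucker x y c0 c3

    u v : Vec4
    u = cubic (plucker x y c1 c3 * w) (- 1#) 0# (plucker x y c0 c1 * w)
    v = cubic (plucker x y c2 c3 * w) 0# (- 1#) (plucker x y c0 c2 * w)

    eval-u : ∀ l m → let t₁ = l * x c1 + m * y c1 in
             eval u (lincomb l x m y) ≈ t₁ * (p₀₃ * w - 1#)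
    eval-u l m = solve 12
      (λ l m x0 x1 x2 x3 y0 y1 y2 y3 w one →
        let t0 = l :* x0 :+ m :* y0
            t1 = l :* x1 :+ m :* y1
            t2 = l :* x2 :+ m :* y2
            t3 = l :* x3 :+ m :* y3
        in (x1 :* y3 :- x3 :* y1) :* w :* t0 :+ (:- one) :* t1 :+ con (+ 0) :* t2
             :+ (x0 :* y1 :- x1 :* y0) :* w :* t3
           := t1 :* ((x0 :* y3 :- x3 :* y0) :* w :- one))
      refl l m (x c0) (x c1) (x c2) (x c3) (y c0) (y c1) (y c2) (y c3) w 1#

    eval-v : ∀ l m → let t₂ = l * x c2 + m * y c2 in
             eval v (lincomb l x m y) ≈ t₂ * (p₀₃ * w - 1#)
    eval-v l m = solve 12
      (λ l m x0 x1 x2 x3 y0 y1 y2 y3 w one →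
        let t0 = l :* x0 :+ m :* y0
            t1 = l :* x1 :+ m :* y1
            t2 = l :* x2 :+ m :* y2
            t3 = l :* x3 :+ m :* y3
        in (x2 :* y3 :- x3 :* y2) :* w :* t0 :+ con (+ 0) :* t1 :+ (:- one) :* t2
             :+ (x0 :* y2 :- x2 :* y0) :* w :* t3
           := t2 :* ((x0 :* y3 :- x3 :* y0) :* w :- one))
      refl l m (x c0) (x c1) (x c2) (x c3) (y c0) (y c1) (y c2) (y c3) w 1#

    plucker-relation₀ : ∀ a → a c0 * (p₀₃ * w) ≈
      (- a c1) * u c0 + (- a c2) * v c0 + w * (y c3 * eval a x + (- x c3) * eval a y)
    plucker-relation₀ a = solve 13
      (λ a0 a1 a2 a3 x0 x1 x2 x3 y0 y1 y2 y3 w →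
        let ax = a0 :* x0 :+ a1 :* x1 :+ a2 :* x2 :+ a3 :* x3
            ay = a0 :* y0 :+ a1 :* y1 :+ a2 :* y2 :+ a3 :* y3
        in a0 :* ((x0 :* y3 :- x3 :* y0) :* w)
           := (:- a1) :* ((x1 :* y3 :- x3 :* y1) :* w) :+ (:- a2) :* ((x2 :* y3 :- x3 :* y2) :* w)
              :+ w :* (y3 :* ax :+ (:- x3) :* ay))
      refl (a c0) (a c1) (a c2) (a c3) (x c0) (x c1) (x c2) (x c3) (y c0) (y c1) (y c2) (y c3) w

    plucker-relation₃ : ∀ a → a c3 * (p₀₃ * w) ≈
      (- a c1) * u c3 + (- a c2) * v c3 + w * (x c0 * eval a y + (- y c0) * eval a x)
    plucker-relation₃ a = solve 13
      (λ a0 a1 a2 a3 x0 x1 x2 x3 y0 y1 y2 y3 w →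
        let ax = a0 :* x0 :+ a1 :* x1 :+ a2 :* x2 :+ a3 :* x3
            ay = a0 :* y0 :+ a1 :* y1 :+ a2 :* y2 :+ a3 :* y3
        in a3 :* ((x0 :* y3 :- x3 :* y0) :* w)
           := (:- a1) :* ((x0 :* y1 :- x1 :* y0) :* w) :+ (:- a2) :* ((x0 :* y2 :- x2 :* y0) :* w)
              :+ w :* (x0 :* ay :+ (:- y0) :* ax))
      refl (a c0) (a c1) (a c2) (a c3) (x c0) (x c1) (x c2) (x c3) (y c0) (y c1) (y c2) (y c3) w

    module Normalised (p₀₃w≈1 : p₀₃ * w ≈ 1#) where
      p₀₃w-1≈0 : p₀₃ * w - 1# ≈ 0#
      p₀₃w-1≈0 = trans (+-congʳ p₀₃w≈1) (-‿inverseʳ 1#)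

      eval-u≈0 : ∀ l m → eval u (lincomb l x m y) ≈ 0#
      eval-u≈0 l m = trans (eval-u l m) (trans (*-congˡ p₀₃w-1≈0) (zeroʳ _))

      eval-v≈0 : ∀ l m → eval v (lincomb l x m y) ≈ 0#
      eval-v≈0 l m = trans (eval-v l m) (trans (*-congˡ p₀₃w-1≈0) (zeroʳ _))

      inPencil⇒containsLine : ∀ {a} → InPencil u v a → ContainsLine a x y
      inPencil⇒containsLine {a} (l , m , a≈) z (_ , λ′ , μ , z≈) = begin
        eval a z                                  ≈⟨ eval-congˡ z a≈ ⟩
        eval (lincomb l u m v) z                  ≈⟨ eval-congʳ (lincomb l u m v) z≈ ⟩
        eval (lincomb l u m v) t                  ≈⟨ eval-lincombˡ l u m v t ⟩
        l * eval u t + m * eval v t               ≈⟨ combination-of-zeros l m (eval-u≈0 λ′ μ) (eval-v≈0 λ′ μ) ⟩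
        0#                                        ∎
        where t = lincomb λ′ x μ y

      relation⇒coefficient : ∀ {k T} E → k * (p₀₃ * w) ≈ T + w * E → E ≈ 0# → k ≈ T
      relation⇒coefficient {k} {T} E relation E≈0 = begin
        k                 ≈⟨ *-identityʳ k ⟨
        k * 1#            ≈⟨ *-congˡ p₀₃w≈1 ⟨
        k * (p₀₃ * w)     ≈⟨ relation ⟩
        T + w * E         ≈⟨ +-congˡ (trans (*-congˡ E≈0) (zeroʳ w)) ⟩
        T + 0#            ≈⟨ +-identityʳ T ⟩
        T                 ∎

      eval≈0⇒inPencil : ∀ a → eval a x ≈ 0# → eval a y ≈ 0# → InPencil u v a
      eval≈0⇒inPencil a ax≈0 ay≈0 = - a c1 , - a c2 , coefficient
        where
        coefficient : ∀ i → a i ≈ (- a c1) * u i + (- a c2) * v i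
        coefficient zero = relation⇒coefficient _ (plucker-relation₀ a)
          (combination-of-zeros (y c3) (- x c3) ax≈0 ay≈0)
        coefficient (suc zero) = trans (sym (*-identityʳ _)) (solve 3
          (λ a₁ a₂ one → a₁ :* one := (:- a₁) :* (:- one) :+ (:- a₂) :* con (+ 0)) refl (a c1) (a c2) 1#)
        coefficient (suc (suc zero)) = trans (sym (*-identityʳ _)) (solve 3
          (λ a₁ a₂ one → a₂ :* one := (:- a₁) :* con (+ 0) :+ (:- a₂) :* (:- one)) refl (a c1) (a c2) 1#)
        coefficient (suc (suc (suc zero))) = relation⇒coefficient _ (plucker-relation₃ a)
          (combination-of-zeros (x c0) (- y c0) ay≈0 ax≈0)

corollary6p3 : ∀ {c ℓ : Level} (R : CommutativeRing c ℓ) (h : ℕ) →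
  IsFieldOfOrder R (3 ^ h) →
  let open CommutativeRing R
      open PG3 R
  in ∀ (x y : Vec4) → IsPoint x → IsPoint y → ¬ SamePoint x y →
     AvoidsAxis x y →
     ∀ (w : Carrier) → plucker x y c0 c3 * w ≈ 1# →
     let z0 = plucker x y c2 c3 * w
         z1 = plucker x y c1 c3 * w
         z3 = plucker x y c0 c2 * w
         z4 = plucker x y c0 c1 * w
     in ∀ (a : Vec4) → IsPoint a →
        (ContainsLine a x y ⇔ InPencil (cubic z1 (- 1#) 0# z4) (cubic z0 0# (- 1#) z3) a)
corollary6p3 R _ _ x y px py _ _ w p₀₃w≈1 a _ =
  mk⇔ (λ contains → let (ax≈0 , ay≈0) = containsLine⇒eval≈0 a px py contains
                    in eval≈0⇒inPencil a ax≈0 ay≈0)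
      inPencil⇒containsLine
  where
  open PlanesThroughLine R
  open Pencil x y w
  open Normalised p₀₃w≈1
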